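{- Let $\mathbb{V}$ be a variety of bounded residuated lattices, and let $s(x)$ and $t(x)$ be unary terms, each of which is both a Boolean term and a radical term for $\mathbb{V}$ and satisfies, for some $m,n>0$ (depending on the term), $\mathbb{V}\models (x^m\to u(x))\cdot(u(x)\to n.x)\approx\top$ with $u\in\{s,t\}$. Then $\mathbb{V}\models s(x)\approx t(x)$.
   Context: A bounded residuated lattice is an algebra $\langle A;\cdot,\to,\lor,\land,\top,\bot\rangle$ with $\langle A;\cdot,\top\rangle$ a commutative monoid, $\langle A;\lor,\land,\bot,\top\rangle$ a bounded lattice (least $\bot$, greatest $\top$), and $a\cdot b\le c$ iff $a\le b\to c$. Put $\neg x=x\to\bot$, $x+y=\neg(\neg x\cdot\neg y)$, $x^0=\top$, $x^{n+1}=x\cdot x^n$, $0.x=\bot$, $(n+1).x=x+n.x$. An implicative filter is a subset containing $\top$, upward closed and closed under $\cdot$; $Rad(\mathbf{A})$ is the intersection of the maximal implicative filters not containing $\bot$. A unary term $t(x)$ is a radical term for $\mathbf{A}$ if $Rad(\mathbf{A})=\{a: t^{\mathbf{A}}(a)=\top\}$. $B(\mathbf{A})=\{b: b\lor\neg b=\top\}$; $b(x)$ is a Boolean term for $\mathbf{A}$ if $b^{\mathbf{A}}(a)\in B(\mathbf{A})$ for all $a$ and $b^{\mathbf{A}}(\top)\neq b^{\mathbf{A}}(\bot)$. A term is a Boolean (radical) term for a variety if it is one for every member. -}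

module Defs where

open import Level using (Level; suc; _⊔_; 0ℓ)
open import Data.Nat using (ℕ; zero; _<_) renaming (suc to 1+)
open import Data.Fin using (Fin)
open import Data.Product using (_×_; _,_; Σ)
open import Relation.Nullary using (¬_)
open import Relation.Unary using (Pred; _⊆_)
open import Relation.Binary using (Rel)
open import Algebra.Structures using (IsCommutativeMonoid)
open import Algebra.Lattice.Structures using (IsLattice)

record BRL (ℓ : Level) : Set (suc ℓ) where
  infixl 7 _·_
  infixr 5 _⇒_
  infixr 6 _∨_ _∧_
  infix 4 _≈_ _≤_
  field
    Carrier : Set ℓ
    _≈_     : Rel Carrier ℓ
    _·_     : Carrier → Carrier → Carrier
    _⇒_     : Carrier → Carrier → Carrier
    _∨_     : Carrier → Carrier → Carrier
    _∧_     : Carrier → Carrier → Carrier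
    ⊤       : Carrier
    ⊥       : Carrier
    isCommutativeMonoid : IsCommutativeMonoid _≈_ _·_ ⊤
    isLattice           : IsLattice _≈_ _∨_ _∧_
    ⇒-cong  : ∀ {a a′ b b′} → a ≈ a′ → b ≈ b′ → (a ⇒ b) ≈ (a′ ⇒ b′)

  _≤_ : Carrier → Carrier → Set ℓ
  a ≤ b = (a ∧ b) ≈ a

  field
    ⊥-least    : ∀ a → ⊥ ≤ a
    ⊤-greatest : ∀ a → a ≤ ⊤
    residuated : ∀ a b c → ((a · b) ≤ c → a ≤ (b ⇒ c)) × (a ≤ (b ⇒ c) → (a · b) ≤ c)

  ∼_ : Carrier → Carrier
  ∼ a = a ⇒ ⊥

  _+_ : Carrier → Carrier → Carrier
  a + b = ∼ ((∼ a) · (∼ b))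

  _^_ : Carrier → ℕ → Carrier
  a ^ zero = ⊤
  a ^ 1+ n = a · (a ^ n)

  _∙_ : ℕ → Carrier → Carrier
  zero ∙ a = ⊥
  1+ n ∙ a = a + (n ∙ a)

  record IsImpFilter (F : Pred Carrier ℓ) : Set ℓ where
    field
      ⊤∈     : F ⊤
      upward : ∀ {a b} → a ≤ b → F a → F b
      ·-closed : ∀ {a b} → F a → F b → F (a · b)

  record IsMaximalFilter (F : Pred Carrier ℓ) : Set (suc ℓ) where
    field
      isFilter : IsImpFilter F
      proper   : ¬ F ⊥
      maximal  : ∀ (G : Pred Carrier ℓ) → IsImpFilter G → ¬ G ⊥ → F ⊆ G → G ⊆ F

  Rad : Pred Carrier (suc ℓ)
  Rad a = ∀ (F : Pred Carrier ℓ) → IsMaximalFilter F → F a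

  IsBoolean : Carrier → Set ℓ
  IsBoolean b = (b ∨ (∼ b)) ≈ ⊤

  Nontrivial : Set ℓ
  Nontrivial = ¬ (⊤ ≈ ⊥)

data Term (V : Set) : Set where
  var      : V → Term V
  _·ₜ_     : Term V → Term V → Term V
  _⇒ₜ_     : Term V → Term V → Term V
  _∨ₜ_     : Term V → Term V → Term V
  _∧ₜ_     : Term V → Term V → Term V
  ⊤ₜ       : Term V
  ⊥ₜ       : Term V

module _ {ℓ : Level} (A : BRL ℓ) where
  open BRL A

  ⟦_⟧ : {V : Set} → Term V → (V → Carrier) → Carrier
  ⟦ var v ⟧ ρ    = ρ v
  ⟦ p ·ₜ q ⟧ ρ   = ⟦ p ⟧ ρ · ⟦ q ⟧ ρ
  ⟦ p ⇒ₜ q ⟧ ρ   = ⟦ p ⟧ ρ ⇒ ⟦ q ⟧ ρ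
  ⟦ p ∨ₜ q ⟧ ρ   = ⟦ p ⟧ ρ ∨ ⟦ q ⟧ ρ
  ⟦ p ∧ₜ q ⟧ ρ   = ⟦ p ⟧ ρ ∧ ⟦ q ⟧ ρ
  ⟦ ⊤ₜ ⟧ ρ       = ⊤
  ⟦ ⊥ₜ ⟧ ρ       = ⊥

UTerm : Set
UTerm = Term (Fin 1)

_⟨_⟩ : ∀ {ℓ} {A : BRL ℓ} → UTerm → BRL.Carrier A → BRL.Carrier A
_⟨_⟩ {A = A} t a = ⟦ A ⟧ t (λ _ → a)

Equations : Set₁
Equations = Pred (Term ℕ × Term ℕ) 0ℓ

_⊨_ : ∀ {ℓ} → BRL ℓ → Equations → Set ℓ
A ⊨ E = ∀ {p q} → E (p , q) → ∀ (ρ : ℕ → BRL.Carrier A) →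
        BRL._≈_ A (⟦ A ⟧ p ρ) (⟦ A ⟧ q ρ)

module _ (ℓ : Level) (E : Equations) where

  BooleanTermFor : UTerm → Set (suc ℓ)
  BooleanTermFor t = ∀ (A : BRL ℓ) → A ⊨ E → BRL.Nontrivial A →
    (∀ a → BRL.IsBoolean A (_⟨_⟩ {A = A} t a)) ×
    ¬ (BRL._≈_ A (_⟨_⟩ {A = A} t (BRL.⊤ A)) (_⟨_⟩ {A = A} t (BRL.⊥ A)))

  RadicalTermFor : UTerm → Set (suc ℓ)
  RadicalTermFor t = ∀ (A : BRL ℓ) → A ⊨ E → ∀ a →
    (BRL.Rad A a → BRL._≈_ A (_⟨_⟩ {A = A} t a) (BRL.⊤ A)) ×
    (BRL._≈_ A (_⟨_⟩ {A = A} t a) (BRL.⊤ A) → BRL.Rad A a)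

  BoundedTerm : UTerm → Set (suc ℓ)
  BoundedTerm u = Σ ℕ λ m → Σ ℕ λ n → (0 < m) × (0 < n) ×
    (∀ (A : BRL ℓ) → A ⊨ E → ∀ a →
      let open BRL A in
      (((a ^ m) ⇒ (_⟨_⟩ {A = A} u a)) · ((_⟨_⟩ {A = A} u a) ⇒ (n ∙ a))) ≈ ⊤)

  VSatisfies : UTerm → UTerm → Set (suc ℓ)
  VSatisfies s t = ∀ (A : BRL ℓ) → A ⊨ E → ∀ a →
    BRL._≈_ A (_⟨_⟩ {A = A} s a) (_⟨_⟩ {A = A} t a)

-- A Boolean element d splits an algebra: x ≈ y as soon as d · x ≈ d · y and
-- ∼ d · x ≈ ∼ d · y, and x ↦ d · x respects every term operation.  Take
-- b = s(a) Boolean and e = ∼ b ∨ a.  Then e agrees with a below b and with ⊤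
-- below ∼ b, so s(e) agrees with s(a) = b below b and with s(⊤) = ⊤ below ∼ b,
-- i.e. s(e) = ⊤.  Hence e lies in the radical, so t(e) = ⊤ as well, and
-- b = b · t(e) = b · t(a) ≤ t(a).  By symmetry s(a) = t(a) in every nontrivial
-- member.  As triviality is not decidable, this only gives ¬¬(s(a) = t(a)).  The
-- double negation is removed in the quotient of A that identifies everything if
-- s(a) = t(a): it has no maximal filters, so there s(a) and t(a) lie in the
-- radical and both equal ⊤.

module Submission where

open import Defs
open import Level using (Level)
open import Data.Product using (_,_; proj₁; proj₂)
open import Data.Sum using (_⊎_; inj₁; inj₂)
open import Data.Empty using (⊥-elim)
open import Relation.Nullary using (¬_)
open import Relation.Binary using (Setoid; IsEquivalence)
open import Relation.Binary.PropositionalEquality as ≡ using (_≡_)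
open import Algebra.Structures using (IsCommutativeMonoid)
open import Algebra.Lattice.Structures using (IsLattice)
open import Algebra.Bundles using (CommutativeSemigroup)
open import Algebra.Lattice.Bundles using (Lattice)
import Algebra.Properties.CommutativeSemigroup as CommutativeSemigroupProperties
import Algebra.Lattice.Properties.Lattice as LatticeProperties
import Relation.Binary.Lattice.Bundles as OrderTheoretic

module BRLProperties {ℓ : Level} (A : BRL ℓ) where

  open BRL A
  open IsCommutativeMonoid isCommutativeMonoid public
    using (comm; assoc; identityʳ; ∙-congˡ; ∙-congʳ)
  open IsLattice isLattice public
    using (refl; sym; trans; ∨-cong; ∧-cong; ∨-comm; ∧-comm)

  setoid : Setoid ℓ ℓ
  setoid = record { isEquivalence = IsLattice.isEquivalence isLattice }

  open import Relation.Binary.Reasoning.Setoid setoid public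

  private
    lattice : Lattice ℓ ℓ
    lattice = record { isLattice = isLattice }
    module L = LatticeProperties lattice
    -- The library order is x ⊑ y = x ≈ x ∧ y, the symmetric form of _≤_.
    module O = OrderTheoretic.Lattice L.∨-∧-orderTheoreticLattice

  ·-commutativeSemigroup : CommutativeSemigroup ℓ ℓ
  ·-commutativeSemigroup = record
    { isCommutativeSemigroup = IsCommutativeMonoid.isCommutativeSemigroup isCommutativeMonoid }

  ∧-commutativeSemigroup : CommutativeSemigroup ℓ ℓ
  ∧-commutativeSemigroup = record
    { isCommutativeSemigroup = record { isSemigroup = L.∧-isSemigroup ; comm = ∧-comm } }

  module · = CommutativeSemigroupProperties ·-commutativeSemigroup
  module ∧ = CommutativeSemigroupProperties ∧-commutativeSemigroup

  ≈⇒≤ : ∀ {x y} → x ≈ y → x ≤ y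
  ≈⇒≤ p = sym (O.reflexive p)

  ≤-refl : ∀ {x} → x ≤ x
  ≤-refl = ≈⇒≤ refl

  ≤-trans : ∀ {x y z} → x ≤ y → y ≤ z → x ≤ z
  ≤-trans p q = sym (O.trans (sym p) (sym q))

  ≤-antisym : ∀ {x y} → x ≤ y → y ≤ x → x ≈ y
  ≤-antisym p q = O.antisym (sym p) (sym q)

  x≤x∨y : ∀ x y → x ≤ x ∨ y
  x≤x∨y x y = sym (O.x≤x∨y x y)

  y≤x∨y : ∀ x y → y ≤ x ∨ y
  y≤x∨y x y = sym (O.y≤x∨y x y)

  ∨-least : ∀ {x y z} → x ≤ z → y ≤ z → x ∨ y ≤ z
  ∨-least p q = sym (O.∨-least (sym p) (sym q))

  x∧y≤x : ∀ x y → x ∧ y ≤ x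
  x∧y≤x x y = sym (O.x∧y≤x x y)

  x∧y≤y : ∀ x y → x ∧ y ≤ y
  x∧y≤y x y = sym (O.x∧y≤y x y)

  ∧-greatest : ∀ {x y z} → x ≤ y → x ≤ z → x ≤ y ∧ z
  ∧-greatest p q = sym (O.∧-greatest (sym p) (sym q))

  ≤⊥⇒≈⊥ : ∀ {x} → x ≤ ⊥ → x ≈ ⊥
  ≤⊥⇒≈⊥ p = ≤-antisym p (⊥-least _)

  ⊤≤⇒≈⊤ : ∀ {x} → ⊤ ≤ x → x ≈ ⊤
  ⊤≤⇒≈⊤ p = ≤-antisym (⊤-greatest _) p

  x≤y⇒x∨y≈y : ∀ {x y} → x ≤ y → x ∨ y ≈ y
  x≤y⇒x∨y≈y {x} {y} p = ≤-antisym (∨-least p ≤-refl) (y≤x∨y x y)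

  ⊤≈⊥⇒≈ : ⊤ ≈ ⊥ → ∀ x y → x ≈ y
  ⊤≈⊥⇒≈ ⊤≈⊥ x y = trans (≈⊥ x) (sym (≈⊥ y))
    where
    ≈⊥ : ∀ x → x ≈ ⊥
    ≈⊥ x = ≤⊥⇒≈⊥ (≤-trans (⊤-greatest x) (≈⇒≤ ⊤≈⊥))

  ≤-⇒ : ∀ {x y z} → x · y ≤ z → x ≤ y ⇒ z
  ≤-⇒ = proj₁ (residuated _ _ _)

  ⇒-≤ : ∀ {x y z} → x ≤ y ⇒ z → x · y ≤ z
  ⇒-≤ = proj₂ (residuated _ _ _)

  modus-ponens : ∀ x y → (x ⇒ y) · x ≤ y
  modus-ponens x y = ⇒-≤ ≤-refl

  ·-monoˡ : ∀ {x y} z → x ≤ y → x · z ≤ y · z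
  ·-monoˡ z p = ⇒-≤ (≤-trans p (≤-⇒ ≤-refl))

  ·-monoʳ : ∀ z {x y} → x ≤ y → z · x ≤ z · y
  ·-monoʳ z {x} {y} p = ≤-trans (≈⇒≤ (comm z x)) (≤-trans (·-monoˡ z p) (≈⇒≤ (comm y z)))

  x·y≤x : ∀ x y → x · y ≤ x
  x·y≤x x y = ≤-trans (·-monoʳ x (⊤-greatest y)) (≈⇒≤ (identityʳ x))

  x·y≤y : ∀ x y → x · y ≤ y
  x·y≤y x y = ≤-trans (≈⇒≤ (comm x y)) (x·y≤x y x)

  ·-distribˡ-∨ : ∀ z x y → z · (x ∨ y) ≈ z · x ∨ z · y
  ·-distribˡ-∨ z x y = ≤-antisym
    (≤-trans (≈⇒≤ (comm z (x ∨ y))) (⇒-≤ (∨-least (below x (x≤x∨y _ _)) (below y (y≤x∨y _ _)))))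
    (∨-least (·-monoʳ z (x≤x∨y x y)) (·-monoʳ z (y≤x∨y x y)))
    where
    below : ∀ w → z · w ≤ z · x ∨ z · y → w ≤ z ⇒ (z · x ∨ z · y)
    below w p = ≤-⇒ (≤-trans (≈⇒≤ (comm w z)) p)

  x·∼x≈⊥ : ∀ x → x · ∼ x ≈ ⊥
  x·∼x≈⊥ x = ≤⊥⇒≈⊥ (≤-trans (≈⇒≤ (comm x (∼ x))) (modus-ponens x ⊥))

  x≤∼∼x : ∀ x → x ≤ ∼ (∼ x)
  x≤∼∼x x = ≤-⇒ (≈⇒≤ (x·∼x≈⊥ x))

  boolean-·-idem : ∀ {d} → IsBoolean d → d · d ≈ d
  boolean-·-idem {d} d-boolean = sym (begin
    d                ≈⟨ identityʳ d ⟨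
    d · ⊤            ≈⟨ ∙-congˡ d-boolean ⟨
    d · (d ∨ ∼ d)    ≈⟨ ·-distribˡ-∨ d d (∼ d) ⟩
    d · d ∨ d · ∼ d  ≈⟨ ∨-cong refl (x·∼x≈⊥ d) ⟩
    d · d ∨ ⊥        ≈⟨ ∨-comm _ _ ⟩
    ⊥ ∨ d · d        ≈⟨ x≤y⇒x∨y≈y (⊥-least _) ⟩
    d · d            ∎)

  boolean-∼ : ∀ {d} → IsBoolean d → IsBoolean (∼ d)
  boolean-∼ {d} d-boolean = ⊤≤⇒≈⊤ (≤-trans (≈⇒≤ (sym d-boolean))
    (∨-least (≤-trans (x≤∼∼x d) (y≤x∨y _ _)) (x≤x∨y _ _)))

  infix 4 _≈[_]_
  _≈[_]_ : Carrier → Carrier → Carrier → Set ℓ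
  x ≈[ d ] y = d · x ≈ d · y

  module BooleanElement (d : Carrier) (d-boolean : IsBoolean d) where

    ·-idem : d · d ≈ d
    ·-idem = boolean-·-idem d-boolean

    ·≈∧ : ∀ x → d · x ≈ d ∧ x
    ·≈∧ x = ≤-antisym (∧-greatest (x·y≤x d x) (x·y≤y d x)) ∧≤·
      where
      ∧≤· : d ∧ x ≤ d · x
      ∧≤· = ≤-trans (≈⇒≤ (trans (sym (identityʳ (d ∧ x))) (∙-congˡ (sym d-boolean))))
        (≤-trans (≈⇒≤ (·-distribˡ-∨ (d ∧ x) d (∼ d)))
          (∨-least (≤-trans (·-monoˡ d (x∧y≤y d x)) (≈⇒≤ (comm x d)))
                   (≤-trans (·-monoˡ (∼ d) (x∧y≤x d x)) (≤-trans (≈⇒≤ (x·∼x≈⊥ d)) (⊥-least _)))))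

    ·-cong-mod : ∀ {x y x′ y′} → x ≈[ d ] x′ → y ≈[ d ] y′ → x · y ≈[ d ] x′ · y′
    ·-cong-mod {x} {y} {x′} {y′} p q = begin
      d · (x · y)          ≈⟨ ∙-congʳ ·-idem ⟨
      (d · d) · (x · y)    ≈⟨ ·.interchange d d x y ⟩
      (d · x) · (d · y)    ≈⟨ ∙-congˡ q ⟩
      (d · x) · (d · y′)   ≈⟨ ∙-congʳ p ⟩
      (d · x′) · (d · y′)  ≈⟨ ·.interchange d d x′ y′ ⟨
      (d · d) · (x′ · y′)  ≈⟨ ∙-congʳ ·-idem ⟩
      d · (x′ · y′)        ∎

    ∨-cong-mod : ∀ {x y x′ y′} → x ≈[ d ] x′ → y ≈[ d ] y′ → x ∨ y ≈[ d ] x′ ∨ y′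
    ∨-cong-mod {x} {y} {x′} {y′} p q =
      trans (·-distribˡ-∨ d x y) (trans (∨-cong p q) (sym (·-distribˡ-∨ d x′ y′)))

    ∧-cong-mod : ∀ {x y x′ y′} → x ≈[ d ] x′ → y ≈[ d ] y′ → x ∧ y ≈[ d ] x′ ∧ y′
    ∧-cong-mod {x} {y} {x′} {y′} p q = begin
      d · (x ∧ y)          ≈⟨ ·≈∧ (x ∧ y) ⟩
      d ∧ (x ∧ y)          ≈⟨ ∧-cong (L.∧-idem d) refl ⟨
      (d ∧ d) ∧ (x ∧ y)    ≈⟨ ∧.interchange d d x y ⟩
      (d ∧ x) ∧ (d ∧ y)    ≈⟨ ∧-cong (∧-form p) (∧-form q) ⟩
      (d ∧ x′) ∧ (d ∧ y′)  ≈⟨ ∧.interchange d d x′ y′ ⟨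
      (d ∧ d) ∧ (x′ ∧ y′)  ≈⟨ ∧-cong (L.∧-idem d) refl ⟩
      d ∧ (x′ ∧ y′)        ≈⟨ ·≈∧ (x′ ∧ y′) ⟨
      d · (x′ ∧ y′)        ∎
      where
      ∧-form : ∀ {z z′} → z ≈[ d ] z′ → d ∧ z ≈ d ∧ z′
      ∧-form {z} {z′} r = trans (sym (·≈∧ z)) (trans r (·≈∧ z′))

    ⇒-relativise : ∀ x y → x ⇒ y ≈[ d ] (d · x) ⇒ (d · y)
    ⇒-relativise x y = ≤-antisym (·-monoʳ d weaken) strengthen
      where
      weaken : x ⇒ y ≤ (d · x) ⇒ (d · y)
      weaken = ≤-⇒ (≤-trans (≈⇒≤ (·.x∙yz≈y∙xz (x ⇒ y) d x)) (·-monoʳ d (modus-ponens x y)))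
      drop-d : d · ((d · x) ⇒ (d · y)) ≤ x ⇒ y
      drop-d = ≤-⇒ (≤-trans (≈⇒≤ (trans (assoc d _ x) (·.x∙yz≈y∙xz d _ x)))
        (≤-trans (modus-ponens (d · x) (d · y)) (x·y≤y d y)))
      strengthen : d · ((d · x) ⇒ (d · y)) ≤ d · (x ⇒ y)
      strengthen = ≤-trans (≈⇒≤ (trans (∙-congʳ (sym ·-idem)) (assoc d d _))) (·-monoʳ d drop-d)

    ⇒-cong-mod : ∀ {x y x′ y′} → x ≈[ d ] x′ → y ≈[ d ] y′ → x ⇒ y ≈[ d ] x′ ⇒ y′
    ⇒-cong-mod {x} {y} {x′} {y′} p q =
      trans (⇒-relativise x y) (trans (∙-congˡ (⇒-cong p q)) (sym (⇒-relativise x′ y′)))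

    ⟦⟧-cong-mod : ∀ {V : Set} (p : Term V) {ρ ρ′ : V → Carrier} →
                  (∀ v → ρ v ≈[ d ] ρ′ v) → ⟦ A ⟧ p ρ ≈[ d ] ⟦ A ⟧ p ρ′
    ⟦⟧-cong-mod (var v)  ρ≈ρ′ = ρ≈ρ′ v
    ⟦⟧-cong-mod (p ·ₜ q) ρ≈ρ′ = ·-cong-mod (⟦⟧-cong-mod p ρ≈ρ′) (⟦⟧-cong-mod q ρ≈ρ′)
    ⟦⟧-cong-mod (p ⇒ₜ q) ρ≈ρ′ = ⇒-cong-mod (⟦⟧-cong-mod p ρ≈ρ′) (⟦⟧-cong-mod q ρ≈ρ′)
    ⟦⟧-cong-mod (p ∨ₜ q) ρ≈ρ′ = ∨-cong-mod (⟦⟧-cong-mod p ρ≈ρ′) (⟦⟧-cong-mod q ρ≈ρ′)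
    ⟦⟧-cong-mod (p ∧ₜ q) ρ≈ρ′ = ∧-cong-mod (⟦⟧-cong-mod p ρ≈ρ′) (⟦⟧-cong-mod q ρ≈ρ′)
    ⟦⟧-cong-mod ⊤ₜ       ρ≈ρ′ = refl
    ⟦⟧-cong-mod ⊥ₜ       ρ≈ρ′ = refl

    ≈-by-cases : ∀ {x y} → x ≈[ d ] y → x ≈[ ∼ d ] y → x ≈ y
    ≈-by-cases {x} {y} p q = begin
      x                    ≈⟨ identityʳ x ⟨
      x · ⊤                ≈⟨ ∙-congˡ d-boolean ⟨
      x · (d ∨ ∼ d)        ≈⟨ ·-distribˡ-∨ x d (∼ d) ⟩
      x · d ∨ x · ∼ d      ≈⟨ ∨-cong (trans (comm x d) (trans p (comm d y)))
                                     (trans (comm x (∼ d)) (trans q (comm (∼ d) y))) ⟩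
      y · d ∨ y · ∼ d      ≈⟨ ·-distribˡ-∨ y d (∼ d) ⟨
      y · (d ∨ ∼ d)        ≈⟨ ∙-congˡ d-boolean ⟩
      y · ⊤                ≈⟨ identityʳ y ⟩
      y                    ∎

    ∼∨-≈[] : ∀ x → ∼ d ∨ x ≈[ d ] x
    ∼∨-≈[] x = begin
      d · (∼ d ∨ x)        ≈⟨ ·-distribˡ-∨ d (∼ d) x ⟩
      d · ∼ d ∨ d · x      ≈⟨ ∨-cong (x·∼x≈⊥ d) refl ⟩
      ⊥ ∨ d · x            ≈⟨ x≤y⇒x∨y≈y (⊥-least _) ⟩
      d · x                ∎

    ∼∨-≈[∼] : ∀ x → ∼ d ∨ x ≈[ ∼ d ] ⊤
    ∼∨-≈[∼] x = begin
      ∼ d · (∼ d ∨ x)      ≈⟨ ·-distribˡ-∨ (∼ d) (∼ d) x ⟩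
      ∼ d · ∼ d ∨ ∼ d · x  ≈⟨ ∨-cong (boolean-·-idem (boolean-∼ d-boolean)) refl ⟩
      ∼ d ∨ ∼ d · x        ≈⟨ ∨-comm _ _ ⟩
      ∼ d · x ∨ ∼ d        ≈⟨ x≤y⇒x∨y≈y (x·y≤x (∼ d) x) ⟩
      ∼ d                  ≈⟨ identityʳ (∼ d) ⟨
      ∼ d · ⊤              ∎

-- The quotient of A by the congruence that is total if G holds and the identity
-- otherwise; G need not be decidable, so the equality is weakened to _≈_ ⊎ G.
collapse : ∀ {ℓ} → BRL ℓ → Set ℓ → BRL ℓ
collapse {ℓ} A G = record
  { Carrier = Carrier ; _≈_ = _≈ᴳ_
  ; _·_ = _·_ ; _⇒_ = _⇒_ ; _∨_ = _∨_ ; _∧_ = _∧_ ; ⊤ = ⊤ ; ⊥ = ⊥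
  ; isCommutativeMonoid = record
    { isMonoid = record
      { isSemigroup = record
        { isMagma = record { isEquivalence = ≈ᴳ-isEquivalence ; ∙-cong = lift₂ ∙-cong }
        ; assoc = λ x y z → inj₁ (assoc x y z) }
      ; identity = (λ x → inj₁ (identityˡ x)) , (λ x → inj₁ (identityʳ x)) }
    ; comm = λ x y → inj₁ (comm x y) }
  ; isLattice = record
    { isEquivalence = ≈ᴳ-isEquivalence
    ; ∨-comm = λ x y → inj₁ (∨-comm x y)
    ; ∨-assoc = λ x y z → inj₁ (∨-assoc x y z)
    ; ∨-cong = lift₂ ∨-cong
    ; ∧-comm = λ x y → inj₁ (∧-comm x y)
    ; ∧-assoc = λ x y z → inj₁ (∧-assoc x y z)
    ; ∧-cong = lift₂ ∧-cong
    ; absorptive = (λ x y → inj₁ (∨-absorbs-∧ x y)) , (λ x y → inj₁ (∧-absorbs-∨ x y)) }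
  ; ⇒-cong = lift₂ ⇒-cong
  ; ⊥-least = λ x → inj₁ (⊥-least x)
  ; ⊤-greatest = λ x → inj₁ (⊤-greatest x)
  ; residuated = λ x y z → lift (proj₁ (residuated x y z)) , lift (proj₂ (residuated x y z))
  }
  where
  open BRL A
  open IsCommutativeMonoid isCommutativeMonoid using (assoc; comm; ∙-cong; identityˡ; identityʳ)
  open IsLattice isLattice

  _≈ᴳ_ : Carrier → Carrier → Set ℓ
  x ≈ᴳ y = (x ≈ y) ⊎ G

  lift : ∀ {P Q : Set ℓ} → (P → Q) → P ⊎ G → Q ⊎ G
  lift f (inj₁ p) = inj₁ (f p)
  lift f (inj₂ g) = inj₂ g

  lift₂ : ∀ {f : Carrier → Carrier → Carrier} →
          (∀ {x x′ y y′} → x ≈ x′ → y ≈ y′ → f x y ≈ f x′ y′) →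
          ∀ {x x′ y y′} → x ≈ᴳ x′ → y ≈ᴳ y′ → f x y ≈ᴳ f x′ y′
  lift₂ cong (inj₁ p) (inj₁ q) = inj₁ (cong p q)
  lift₂ cong (inj₁ p) (inj₂ g) = inj₂ g
  lift₂ cong (inj₂ g) _        = inj₂ g

  ≈ᴳ-isEquivalence : IsEquivalence _≈ᴳ_
  ≈ᴳ-isEquivalence = record
    { refl = inj₁ refl
    ; sym = lift sym
    ; trans = λ { (inj₁ p) (inj₁ q) → inj₁ (trans p q) ; (inj₁ _) (inj₂ g) → inj₂ g ; (inj₂ g) _ → inj₂ g } }

⟦⟧-collapse : ∀ {ℓ} (A : BRL ℓ) (G : Set ℓ) {V : Set} (p : Term V) (ρ : V → BRL.Carrier A) →
              ⟦ collapse A G ⟧ p ρ ≡ ⟦ A ⟧ p ρ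
⟦⟧-collapse A G (var v)  ρ = ≡.refl
⟦⟧-collapse A G (p ·ₜ q) ρ = ≡.cong₂ (BRL._·_ A) (⟦⟧-collapse A G p ρ) (⟦⟧-collapse A G q ρ)
⟦⟧-collapse A G (p ⇒ₜ q) ρ = ≡.cong₂ (BRL._⇒_ A) (⟦⟧-collapse A G p ρ) (⟦⟧-collapse A G q ρ)
⟦⟧-collapse A G (p ∨ₜ q) ρ = ≡.cong₂ (BRL._∨_ A) (⟦⟧-collapse A G p ρ) (⟦⟧-collapse A G q ρ)
⟦⟧-collapse A G (p ∧ₜ q) ρ = ≡.cong₂ (BRL._∧_ A) (⟦⟧-collapse A G p ρ) (⟦⟧-collapse A G q ρ)
⟦⟧-collapse A G ⊤ₜ       ρ = ≡.refl
⟦⟧-collapse A G ⊥ₜ       ρ = ≡.refl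

collapse-⊨ : ∀ {ℓ} (A : BRL ℓ) {E : Equations} (G : Set ℓ) → A ⊨ E → collapse A G ⊨ E
collapse-⊨ A G A⊨E {p} {q} p≈q ρ =
  inj₁ (≡.subst₂ (BRL._≈_ A) (≡.sym (⟦⟧-collapse A G p ρ)) (≡.sym (⟦⟧-collapse A G q ρ)) (A⊨E p≈q ρ))

collapse-Rad : ∀ {ℓ} (A : BRL ℓ) {G : Set ℓ} → ¬ ¬ G → ∀ a → BRL.Rad (collapse A G) a
collapse-Rad A ¬¬G a F F-max = ⊥-elim (¬¬G (λ g → proper (upward (inj₂ g) ⊤∈)))
  where
  open BRL.IsMaximalFilter F-max
  open BRL.IsImpFilter isFilter

module _ {ℓ : Level} (E : Equations) (A : BRL ℓ) (A⊨E : A ⊨ E) where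

  open BRL A
  open BRLProperties A

  infix 9 _[_]
  _[_] : UTerm → Carrier → Carrier
  u [ a ] = _⟨_⟩ {A = A} u a

  radical-at-⊤ : ∀ u → RadicalTermFor ℓ E u → u [ ⊤ ] ≈ ⊤
  radical-at-⊤ u u-radical =
    proj₁ (u-radical A A⊨E ⊤) (λ F F-max → IsImpFilter.⊤∈ (IsMaximalFilter.isFilter F-max))

  radical-≤-at-boolean : ∀ s t → RadicalTermFor ℓ E s → RadicalTermFor ℓ E t →
                         ∀ a → IsBoolean (s [ a ]) → s [ a ] ≤ t [ a ]
  radical-≤-at-boolean s t s-radical t-radical a b-boolean =
    ≤-trans (≈⇒≤ b≈b·t[a]) (x·y≤y b (t [ a ]))
    where
    b e : Carrier
    b = s [ a ]
    e = ∼ b ∨ a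
    open BooleanElement b b-boolean
    module ∼b = BooleanElement (∼ b) (boolean-∼ b-boolean)

    s[e]≈⊤ : s [ e ] ≈ ⊤
    s[e]≈⊤ = ≈-by-cases
      (begin
        b · s [ e ]    ≈⟨ ⟦⟧-cong-mod s (λ _ → ∼∨-≈[] a) ⟩
        b · b          ≈⟨ ·-idem ⟩
        b              ≈⟨ identityʳ b ⟨
        b · ⊤          ∎)
      (begin
        ∼ b · s [ e ]  ≈⟨ ∼b.⟦⟧-cong-mod s (λ _ → ∼∨-≈[∼] a) ⟩
        ∼ b · s [ ⊤ ]  ≈⟨ ∙-congˡ (radical-at-⊤ s s-radical) ⟩
        ∼ b · ⊤        ∎)

    t[e]≈⊤ : t [ e ] ≈ ⊤
    t[e]≈⊤ = proj₁ (t-radical A A⊨E e) (proj₂ (s-radical A A⊨E e) s[e]≈⊤)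

    b≈b·t[a] : b ≈ b · t [ a ]
    b≈b·t[a] = begin
      b              ≈⟨ identityʳ b ⟨
      b · ⊤          ≈⟨ ∙-congˡ t[e]≈⊤ ⟨
      b · t [ e ]    ≈⟨ ⟦⟧-cong-mod t (λ _ → ∼∨-≈[] a) ⟩
      b · t [ a ]    ∎

  boolean-radical-terms-agree : ∀ s t →
    BooleanTermFor ℓ E s → RadicalTermFor ℓ E s →
    BooleanTermFor ℓ E t → RadicalTermFor ℓ E t →
    Nontrivial → ∀ a → s [ a ] ≈ t [ a ]
  boolean-radical-terms-agree s t s-boolean s-radical t-boolean t-radical nontrivial a = ≤-antisym
    (radical-≤-at-boolean s t s-radical t-radical a (proj₁ (s-boolean A A⊨E nontrivial) a))
    (radical-≤-at-boolean t s t-radical s-radical a (proj₁ (t-boolean A A⊨E nontrivial) a))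

  radical-⊤-unless : ∀ u → RadicalTermFor ℓ E u → ∀ {G : Set ℓ} → ¬ ¬ G → ∀ a → (u [ a ] ≈ ⊤) ⊎ G
  radical-⊤-unless u u-radical {G} ¬¬G a =
    ≡.subst (λ x → (x ≈ ⊤) ⊎ G) (⟦⟧-collapse A G u (λ _ → a))
      (proj₁ (u-radical (collapse A G) (collapse-⊨ A {E} G A⊨E) a) (collapse-Rad A ¬¬G a))

  radical-terms-≈-stable : ∀ s t → RadicalTermFor ℓ E s → RadicalTermFor ℓ E t →
                           ∀ a → ¬ ¬ (s [ a ] ≈ t [ a ]) → s [ a ] ≈ t [ a ]
  radical-terms-≈-stable s t s-radical t-radical a ¬¬s≈t
    with radical-⊤-unless s s-radical ¬¬s≈t a | radical-⊤-unless t t-radical ¬¬s≈t a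
  ... | inj₂ s≈t  | _         = s≈t
  ... | inj₁ _    | inj₂ s≈t  = s≈t
  ... | inj₁ s≈⊤  | inj₁ t≈⊤  = trans s≈⊤ (sym t≈⊤)

lemma3p18 : ∀ {ℓ : Level} (E : Equations) (s t : UTerm) →
    BooleanTermFor ℓ E s → RadicalTermFor ℓ E s → BoundedTerm ℓ E s →
    BooleanTermFor ℓ E t → RadicalTermFor ℓ E t → BoundedTerm ℓ E t →
    VSatisfies ℓ E s t
lemma3p18 E s t s-boolean s-radical _ t-boolean t-radical _ A A⊨E a =
  radical-terms-≈-stable E A A⊨E s t s-radical t-radical a λ s≉t →
    s≉t (boolean-radical-terms-agree E A A⊨E s t s-boolean s-radical t-boolean t-radical
          (λ ⊤≈⊥ → s≉t (BRLProperties.⊤≈⊥⇒≈ A ⊤≈⊥ _ _)) a)
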